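{- Let $M$ be the filter automaton over the move alphabet $\sigma=\{a,b,c,x\}$ (described in the context), started in its initial state $0$. For all grid points $(p,q),(r,s)\in\mathbb{N}^2$ with $(p,q)\preceq(r,s)$, i.e. $p\le r$ and $q\le s$, there is exactly one word $w\in\{a,b,c\}^*$ that is accepted by $M$ and whose moves lead from $(p,q)$ to $(r,s)$. Equivalently, exactly one word $w\in\{a,b,c\}^*$ with $|w|_b+|w|_c=r-p$ and $|w|_a+|w|_c=s-q$ contains none of $ab$, $ba$, $ac$, $bc$ as a factor.
   Context: Setting: composition of two weighted transducers $T_1$ and $T_2$ that may contain $\epsilon$-transitions. The output $\epsilon$-labels of $T_1$ are renamed $\epsilon_2$, and a self-loop labeled $\epsilon_1$ is added at every state of $T_1$. The input $\epsilon$-labels of $T_2$ are renamed $\epsilon_1$, and a self-loop labeled $\epsilon_2$ is added at every state of $T_2$. While matching an $\epsilon$-path of $T_1$ against an $\epsilon$-path of $T_2$, there are three possible $\epsilon$-moves: - $b=(\epsilon_2:\epsilon_2)$: advance one step along $T_1$'s $\epsilon$-path and stay in $T_2$; grid displacement $(1,0)$. - $a=(\epsilon_1:\epsilon_1)$: stay in $T_1$ and advance one step in $T_2$; grid displacement $(0,1)$. - $c=(\epsilon_2:\epsilon_1)$: advance in both; grid displacement $(1,1)$. The symbol $x$ stands for a matching move on a non-$\epsilon$ symbol. Composition states along the two $\epsilon$-paths form the grid $\mathbb{N}^2$. Write $(p,q)\preceq(r,s)$ when $(r,s)$ is reachable from $(p,q)$ in this grid. The filter $M$ is the deterministic automaton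 with states $0,1,2$, all final, and initial state $0$. Its transitions are: - $0\xrightarrow{x}0$, $0\xrightarrow{c}0$, $0\xrightarrow{a}1$, $0\xrightarrow{b}2$; - $1\xrightarrow{a}1$, $1\xrightarrow{x}0$; - $2\xrightarrow{b}2$, $2\xrightarrow{x}0$. Equivalently, $M$ accepts exactly the complement of $\sigma^*(ab+ba+ac+bc)\sigma^*$. -}

module Defs where

open import Data.Nat using (ℕ; suc)
open import Data.Product using (_×_; _,_)
open import Data.List using (List; []; _∷_; map)
open import Data.Maybe using (Maybe; just; nothing)
open import Data.Unit using (⊤)
open import Data.Empty using (⊥)

data Move : Set where
  a b c x : Move

data EpsMove : Set where
  a′ b′ c′ : EpsMove

toMove : EpsMove → Move
toMove a′ = a
toMove b′ = b
toMove c′ = c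

data FState : Set where
  s0 s1 s2 : FState

δ : FState → Move → Maybe FState
δ s0 x = just s0
δ s0 c = just s0
δ s0 a = just s1
δ s0 b = just s2
δ s1 a = just s1
δ s1 x = just s0
δ s1 b = nothing
δ s1 c = nothing
δ s2 b = just s2
δ s2 x = just s0
δ s2 a = nothing
δ s2 c = nothing

run : FState → List Move → Maybe FState
run q [] = just q
run q (m ∷ w) with δ q m
... | just q′ = run q′ w
... | nothing = nothing

final : FState → Set
final _ = ⊤

Accepts : List Move → Set
Accepts w with run s0 w
... | just q = final q
... | nothing = ⊥

Point : Set
Point = ℕ × ℕ

stepPt : EpsMove → Point → Point
stepPt b′ (i , j) = (suc i , j)
stepPt a′ (i , j) = (i , suc j)
stepPt c′ (i , j) = (suc i , suc j)

walk : Point → List EpsMove → Point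
walk pt [] = pt
walk pt (m ∷ w) = walk (stepPt m pt) w

-- An accepted word of ε-moves never has a or b before c, and never mixes a with b,
-- so it is cᵏaᵐ or cᵏbᵐ.  Such a word is determined by its displacement (k, k + m)
-- resp. (k + m, k), and every displacement (i, j) arises: c^min(i,j) followed by the
-- surplus in a or b.  Hence for p ≤ r, q ≤ s the unique word is the one of
-- displacement (r ∸ p, s ∸ q).
module Submission where

open import Defs
open import Data.Nat using (ℕ; zero; suc; _+_; _∸_; _≤_)
open import Data.Nat.Properties using (+-suc; m+n∸n≡m; m∸n+n≡m)
open import Data.Product using (_×_; _,_; ∃!)
open import Data.List using (List; []; _∷_; map; foldr; replicate; length)
open import Data.List.Properties using (map-replicate)
open import Data.Maybe using (just; Is-just)
open import Data.Maybe.Relation.Unary.Any using (just)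
open import Data.Unit using (tt)
open import Relation.Binary.PropositionalEquality
  using (_≡_; refl; sym; trans; cong; cong₂; subst; module ≡-Reasoning)

accepts⇒is-just : ∀ w → Accepts w → Is-just (run s0 w)
accepts⇒is-just w _ with run s0 w
... | just _ = just tt

is-just⇒accepts : ∀ w → Is-just (run s0 w) → Accepts w
is-just⇒accepts w _ with run s0 w
... | just _ = tt

run-loop : ∀ {q m} → δ q m ≡ just q → ∀ n → run q (replicate n m) ≡ just q
run-loop loop zero = refl
run-loop loop (suc n) rewrite loop = run-loop loop n

displacement : List EpsMove → Point
displacement = foldr stepPt (0 , 0)

_⊕_ : Point → Point → Point
(i , j) ⊕ (k , l) = (i + k , j + l)

⊕-stepPt : ∀ m d pt → d ⊕ stepPt m pt ≡ stepPt m d ⊕ pt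
⊕-stepPt a′ (i , j) (k , l) = cong (i + k ,_) (+-suc j l)
⊕-stepPt b′ (i , j) (k , l) = cong (_, j + l) (+-suc i k)
⊕-stepPt c′ (i , j) (k , l) = cong₂ _,_ (+-suc i k) (+-suc j l)

walk≡displacement⊕ : ∀ pt w → walk pt w ≡ displacement w ⊕ pt
walk≡displacement⊕ (i , j) [] = refl
walk≡displacement⊕ pt (m ∷ w) =
  trans (walk≡displacement⊕ (stepPt m pt) w) (⊕-stepPt m (displacement w) pt)

⊕-cancelʳ : ∀ {d} p q r s → d ⊕ (p , q) ≡ (r , s) → d ≡ (r ∸ p , s ∸ q)
⊕-cancelʳ {i , j} p q _ _ refl = sym (cong₂ _,_ (m+n∸n≡m i p) (m+n∸n≡m j q))

canonical : Point → List EpsMove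
canonical (suc i , suc j) = c′ ∷ canonical (i , j)
canonical (zero  , j)     = replicate j a′
canonical (suc i , zero)  = replicate (suc i) b′

canonical-stepPt-c′ : ∀ d → canonical (stepPt c′ d) ≡ c′ ∷ canonical d
canonical-stepPt-c′ (i , j) = refl

displacement-replicate-a′ : ∀ n → displacement (replicate n a′) ≡ (0 , n)
displacement-replicate-a′ zero = refl
displacement-replicate-a′ (suc n) = cong (stepPt a′) (displacement-replicate-a′ n)

displacement-replicate-b′ : ∀ n → displacement (replicate n b′) ≡ (n , 0)
displacement-replicate-b′ zero = refl
displacement-replicate-b′ (suc n) = cong (stepPt b′) (displacement-replicate-b′ n)

displacement-canonical : ∀ d → displacement (canonical d) ≡ d
displacement-canonical (suc i , suc j) = cong (stepPt c′) (displacement-canonical (i , j))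
displacement-canonical (zero  , j)     = displacement-replicate-a′ j
displacement-canonical (suc i , zero)  = displacement-replicate-b′ (suc i)

canonical-accepted : ∀ d → Is-just (run s0 (map toMove (canonical d)))
canonical-accepted (suc i , suc j) = canonical-accepted (i , j)
canonical-accepted (zero , zero) = just tt
canonical-accepted (zero , suc j)
  rewrite map-replicate toMove j a′ | run-loop {s1} {a} refl j = just tt
canonical-accepted (suc i , zero)
  rewrite map-replicate toMove i b′ | run-loop {s2} {b} refl i = just tt

live-from-s1⇒replicate-a′ : ∀ w → Is-just (run s1 (map toMove w)) → w ≡ replicate (length w) a′
live-from-s1⇒replicate-a′ [] _ = refl
live-from-s1⇒replicate-a′ (a′ ∷ w) live = cong (a′ ∷_) (live-from-s1⇒replicate-a′ w live)
live-from-s1⇒replicate-a′ (b′ ∷ w) ()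
live-from-s1⇒replicate-a′ (c′ ∷ w) ()

live-from-s2⇒replicate-b′ : ∀ w → Is-just (run s2 (map toMove w)) → w ≡ replicate (length w) b′
live-from-s2⇒replicate-b′ [] _ = refl
live-from-s2⇒replicate-b′ (b′ ∷ w) live = cong (b′ ∷_) (live-from-s2⇒replicate-b′ w live)
live-from-s2⇒replicate-b′ (a′ ∷ w) ()
live-from-s2⇒replicate-b′ (c′ ∷ w) ()

live⇒canonical : ∀ w → Is-just (run s0 (map toMove w)) → w ≡ canonical (displacement w)
live⇒canonical [] _ = refl
live⇒canonical (c′ ∷ w) live =
  trans (cong (c′ ∷_) (live⇒canonical w live)) (sym (canonical-stepPt-c′ (displacement w)))
live⇒canonical (a′ ∷ w) live =
  subst (λ v → a′ ∷ v ≡ canonical (displacement (a′ ∷ v)))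
        (sym (live-from-s1⇒replicate-a′ w live))
        (cong canonical (sym (displacement-replicate-a′ (suc (length w)))))
live⇒canonical (b′ ∷ w) live =
  subst (λ v → b′ ∷ v ≡ canonical (displacement (b′ ∷ v)))
        (sym (live-from-s2⇒replicate-b′ w live))
        (cong canonical (sym (displacement-replicate-b′ (suc (length w)))))

proposition1 : (p q r s : ℕ) → p ≤ r → q ≤ s →
    ∃! _≡_ (λ (w : List EpsMove) → Accepts (map toMove w) × walk (p , q) w ≡ (r , s))
proposition1 p q r s p≤r q≤s = canonical d , (accepted , reaches) , unique
  where
    d : Point
    d = (r ∸ p , s ∸ q)

    accepted : Accepts (map toMove (canonical d))
    accepted = is-just⇒accepts (map toMove (canonical d)) (canonical-accepted d)

    open ≡-Reasoning

    reaches : walk (p , q) (canonical d) ≡ (r , s)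
    reaches = begin
      walk (p , q) (canonical d)               ≡⟨ walk≡displacement⊕ (p , q) (canonical d) ⟩
      displacement (canonical d) ⊕ (p , q)     ≡⟨ cong (_⊕ (p , q)) (displacement-canonical d) ⟩
      (r ∸ p + p , s ∸ q + q)                  ≡⟨ cong₂ _,_ (m∸n+n≡m p≤r) (m∸n+n≡m q≤s) ⟩
      (r , s)                                  ∎

    unique : ∀ {w} → Accepts (map toMove w) × walk (p , q) w ≡ (r , s) → canonical d ≡ w
    unique {w} (acc , walk-w) = begin
      canonical d                 ≡⟨ cong canonical (sym (⊕-cancelʳ p q r s displacement⊕pq≡rs)) ⟩
      canonical (displacement w)  ≡⟨ sym (live⇒canonical w (accepts⇒is-just (map toMove w) acc)) ⟩
      w                           ∎
      where
        displacement⊕pq≡rs : displacement w ⊕ (p , q) ≡ (r , s)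
        displacement⊕pq≡rs = trans (sym (walk≡displacement⊕ (p , q) w)) walk-w
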